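{- Let $q$ be a prime power and $n$ a positive integer coprime to $q$. Then all $q$-cyclotomic cosets modulo $n$ are equal-difference cosets if and only if both of the following hold: (i) $\mathrm{rad}(n)\mid q-1$; (ii) if $8\mid n$, then $q\equiv 1\pmod 4$.
   Context: For $\gamma\in\mathbb{Z}/n\mathbb{Z}$, the $q$-cyclotomic coset modulo $n$ containing $\gamma$ is $c_{n/q}(\gamma)=\{\gamma,\gamma q,\dots,\gamma q^{\tau-1}\}\subseteq\mathbb{Z}/n\mathbb{Z}$, where the size $\tau$ is the least positive integer with $\gamma q^\tau\equiv\gamma\pmod n$. The coset is of equal difference if $\tau\mid n$ and $c_{n/q}(\gamma)=\{\gamma,\gamma+\frac n\tau,\dots,\gamma+(\tau-1)\frac n\tau\}$ in $\mathbb{Z}/n\mathbb{Z}$; one-element cosets are regarded as of equal difference. $\mathrm{rad}(m)$ is the product of the distinct primes dividing $m$. -}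

module Defs where

open import Data.Nat using (ℕ; zero; suc; _+_; _*_; _∸_; _^_; _<_; _≤_; NonZero)
open import Data.Nat.DivMod using (_%_)
open import Data.Nat.Divisibility using (_∣_; _∣?_)
open import Data.Nat.Primality using (Prime; prime?)
open import Data.List using (List; filter; upTo)
open import Data.Nat.ListAction using (product)
open import Data.Product using (Σ; ∃; _×_)
open import Relation.Binary.PropositionalEquality using (_≡_; _≢_)
open import Relation.Nullary.Decidable using (_×-dec_)
open import Function.Bundles using (_⇔_)

IsPrimePower : ℕ → Set
IsPrimePower q = Σ ℕ λ p → Σ ℕ λ k → Prime p × (1 ≤ k) × (q ≡ p ^ k)

rad : ℕ → ℕ
rad m = product (filter (λ p → prime? p ×-dec (p ∣? m)) (upTo (suc m)))

-- Elements of ℤ/nℤ are represented by residues in ℕ (reduced mod n).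
-- x lies in the q-cyclotomic coset c_{n/q}(γ) = {γ q^i mod n : i ∈ ℕ}
InCoset : (n q γ x : ℕ) → .{{_ : NonZero n}} → Set
InCoset n q γ x = ∃ λ i → x % n ≡ (γ * q ^ i) % n

IsCosetSize : (n q γ τ : ℕ) → .{{_ : NonZero n}} → Set
IsCosetSize n q γ τ =
  (0 < τ) × ((γ * q ^ τ) % n ≡ γ % n) ×
  (∀ t → 0 < t → t < τ → (γ * q ^ t) % n ≢ γ % n)

-- the coset of γ is of equal difference: τ ∣ n (τ * d ≡ n, so d = n/τ) and
-- c_{n/q}(γ) = {γ, γ + d, …, γ + (τ-1) d} in ℤ/nℤ
-- (one-element cosets are automatically covered, with τ = 1, d = n).
EqualDifference : (n q γ : ℕ) → .{{_ : NonZero n}} → Set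
EqualDifference n q γ =
  ∀ τ → IsCosetSize n q γ τ →
    Σ ℕ λ d → (τ * d ≡ n) ×
      (∀ x → InCoset n q γ x ⇔ (∃ λ j → (j < τ) × (x % n ≡ (γ + j * d) % n)))

{-# OPTIONS --safe #-}
-- Write q = 1 + r and geom q t = 1 + q + ⋯ + q ^ (t ∸ 1), so that γ q ^ t = γ + γ r · geom q t.
-- With D = gcd (γ r) n and M = n / D, the element γ q ^ t is back at γ modulo n exactly when
-- M ∣ geom q t.  If every prime divisor of n divides r, and 4 ∣ r when 8 ∣ n, then lifting the
-- exponent prime by prime gives M ∣ geom q t ⇔ M ∣ t.  So the coset of γ has size M, and its
-- elements γ + D · (a · geom q t mod M) (a = γ r / D, coprime to M) are exactly the γ + j D, j < M.
-- Conversely, let the coset of 1 be {1 + j d : j < τ}, with τ d = n.  A prime p ∣ n with p ∤ d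
-- divides τ, and then also some 1 + j d with j < p ≤ τ, which is a power of q: impossible.  So p ∣ d,
-- and q ≡ 1 + j d (mod n) gives p ∣ r.  If 8 ∣ n but 4 ∤ d, then 4 ∣ τ and 1 + 2 d ≡ 5 (mod 8) is
-- a power of q, which forces q ≡ 1 (mod 4).
module Submission where

open import Data.Empty using (⊥; ⊥-elim)
open import Data.Fin as Fin using (Fin; toℕ; punchOut)
open import Data.Fin.Properties using (any?; pigeonhole; punchOut-injective; toℕ-fromℕ<; toℕ<n)
open import Data.List using ([]; _∷_; filter; upTo)
open import Data.List.Membership.Propositional.Properties using (∈-filter⁺; ∈-upTo⁺)
open import Data.List.Relation.Unary.All as All using (All; []; _∷_)
open import Data.List.Relation.Unary.All.Properties using (all-filter)
open import Data.List.Relation.Unary.AllPairs using ([]; _∷_)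
open import Data.List.Relation.Unary.Unique.Propositional using (Unique)
open import Data.List.Relation.Unary.Unique.Propositional.Properties using (filter⁺; upTo⁺)
open import Data.Nat
open import Data.Nat.Coprimality as Coprime using (Coprime; coprime-divisor; coprime-/gcd)
open import Data.Nat.Divisibility
open import Data.Nat.DivMod
open import Data.Nat.GCD using (gcd; gcd[m,n]∣m; gcd[m,n]∣n; gcd[m,n]≢0; gcd-greatest; n/gcd[m,n]≢0)
open import Data.Nat.Induction using (<-rec)
open import Data.Nat.ListAction using (product)
open import Data.Nat.ListAction.Properties using (∈⇒∣product)
open import Data.Nat.Primality
open import Data.Nat.Primality.Factorisation using (factorise; factorisationHasAllPrimeFactors)
open import Data.Nat.Properties
open import Data.Nat.Tactic.RingSolver using (solve-∀)
open import Data.Product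
open import Data.Sum using (_⊎_; inj₁; inj₂; [_,_]′)
open import Function.Base using (_∘_; id)
open import Function.Bundles using (_⇔_; mk⇔; Equivalence)
import Function.Properties.Equivalence as ⇔
open import Function.Related.Propositional as Related using ()
open import Relation.Binary.PropositionalEquality
open import Relation.Nullary using (¬_; yes; no; contradiction)
open import Relation.Nullary.Decidable using (_×-dec_)
open import Relation.Unary using (Decidable)

open import Defs

[m+n]%o≡m%o⇒o∣n : ∀ m n o .{{_ : NonZero o}} → (m + n) % o ≡ m % o → o ∣ n
[m+n]%o≡m%o⇒o∣n m n o eq = ∣m+n∣m⇒∣n (divides ((m + n) / o) (+-cancelˡ-≡ (m % o) _ _ (begin
  m % o + (m / o * o + n)        ≡⟨ +-assoc (m % o) _ n ⟨
  m % o + m / o * o + n          ≡⟨ cong (_+ n) (m≡m%n+[m/n]*n m o) ⟨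
  m + n                          ≡⟨ m≡m%n+[m/n]*n (m + n) o ⟩
  (m + n) % o + (m + n) / o * o  ≡⟨ cong (_+ (m + n) / o * o) eq ⟩
  m % o + (m + n) / o * o        ∎))) (n∣m*n (m / o))
  where open ≡-Reasoning

%-≡-divisor : ∀ {m n} a b .{{_ : NonZero m}} .{{_ : NonZero n}} → m ∣ n → a % n ≡ b % n → a % m ≡ b % m
%-≡-divisor {m} {n} a b m∣n eq = begin
  a % m      ≡⟨ m∣n⇒o%n%m≡o%m m n a m∣n ⟨
  a % n % m  ≡⟨ cong (_% m) eq ⟩
  b % n % m  ≡⟨ m∣n⇒o%n%m≡o%m m n b m∣n ⟩
  b % m      ∎
  where open ≡-Reasoning

∣-resp-%≡ : ∀ {m n a b} .{{_ : NonZero m}} .{{_ : NonZero n}} → m ∣ n → a % n ≡ b % n → m ∣ a → m ∣ b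
∣-resp-%≡ {m} {n} {a} {b} m∣n a≡b m∣a =
  m%n≡0⇒n∣m b m (trans (sym (%-≡-divisor a b m∣n a≡b)) (n∣m⇒m%n≡0 a m m∣a))

*-congˡ-% : ∀ {n} c {a b} .{{_ : NonZero n}} → a % n ≡ b % n → (c * a) % n ≡ (c * b) % n
*-congˡ-% {n} c {a} {b} a≡b = begin
  (c * a) % n            ≡⟨ %-distribˡ-* c a n ⟩
  (c % n * (a % n)) % n  ≡⟨ cong (λ x → (c % n * x) % n) a≡b ⟩
  (c % n * (b % n)) % n  ≡⟨ %-distribˡ-* c b n ⟨
  (c * b) % n            ∎
  where open ≡-Reasoning

*-cancelˡ-% : ∀ {n c a b} .{{_ : NonZero n}} → Coprime n c → a ≤ b → (c * a) % n ≡ (c * b) % n → a % n ≡ b % n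
*-cancelˡ-% {n} {c} {a} cop a≤b eq with k , refl ← m≤n⇒∃[o]m+o≡n a≤b =
  sym (%-remove-+ʳ a (coprime-divisor cop ([m+n]%o≡m%o⇒o∣n (c * a) (c * k) n (begin
    (c * a + c * k) % n  ≡⟨ cong (_% n) (*-distribˡ-+ c a k) ⟨
    (c * (a + k)) % n    ≡⟨ eq ⟨
    (c * a) % n          ∎))))
  where open ≡-Reasoning

∃prime∣ : ∀ {m} → 1 < m → ∃ λ p → Prime p × p ∣ m
∃prime∣ {1} (s≤s ())
∃prime∣ {m@(suc (suc _))} _ with factorise m
... | record { factors = p ∷ ps ; isFactorisation = m≡Πps ; factorsPrime = p-prime ∷ _ } =
  p , p-prime , subst (p ∣_) (sym m≡Πps) (m∣m*n (product ps))

noCommonPrime⇒coprime : ∀ {a b} → (∀ {p} → Prime p → p ∣ a → p ∣ b → ⊥) → Coprime a b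
noCommonPrime⇒coprime noCommon {zero} (0∣a , 0∣b) =
  ⊥-elim (noCommon prime[2] (subst (2 ∣_) (sym (0∣⇒≡0 0∣a)) (2 ∣0)) (subst (2 ∣_) (sym (0∣⇒≡0 0∣b)) (2 ∣0)))
noCommonPrime⇒coprime noCommon {1} _ = refl
noCommonPrime⇒coprime noCommon {suc (suc _)} (d∣a , d∣b) with p , p-prime , p∣d ← ∃prime∣ (s≤s (s≤s z≤n)) =
  ⊥-elim (noCommon p-prime (∣-trans p∣d d∣a) (∣-trans p∣d d∣b))

coprime⇒¬commonPrime : ∀ {a b p} → Coprime a b → Prime p → p ∣ a → p ∣ b → ⊥
coprime⇒¬commonPrime cop p-prime p∣a p∣b = ¬prime[1] (subst Prime (cop (p∣a , p∣b)) p-prime)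

prime∤1 : ∀ {p} → Prime p → ¬ p ∣ 1
prime∤1 p-prime p∣1 = ¬prime[1] (subst Prime (∣1⇒≡1 p∣1) p-prime)

prime∣prime⇒≡ : ∀ {p q} → Prime p → Prime q → p ∣ q → p ≡ q
prime∣prime⇒≡ p-prime q-prime p∣q with prime⇒irreducible q-prime p∣q
... | inj₁ refl = ⊥-elim (¬prime[1] p-prime)
... | inj₂ p≡q = p≡q

prime∣^⇒prime∣ : ∀ {p} m i → Prime p → p ∣ m ^ i → p ∣ m
prime∣^⇒prime∣ m zero    p-prime p∣1 = ⊥-elim (prime∤1 p-prime p∣1)
prime∣^⇒prime∣ m (suc i) p-prime p∣m^[1+i] with euclidsLemma m (m ^ i) p-prime p∣m^[1+i]
... | inj₁ p∣m   = p∣m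
... | inj₂ p∣m^i = prime∣^⇒prime∣ m i p-prime p∣m^i

coprime-^ : ∀ {q n} i → Coprime q n → Coprime (q ^ i) n
coprime-^ {q} i cop = noCommonPrime⇒coprime λ p-prime p∣q^i →
  coprime⇒¬commonPrime cop p-prime (prime∣^⇒prime∣ q i p-prime p∣q^i)

coprime⇒*-∣ : ∀ {a b m} → Coprime a b → a ∣ m → b ∣ m → a * b ∣ m
coprime⇒*-∣ {a} {b} cop a∣m (divides k refl) with divides l k≡la ← coprime-divisor cop (subst (a ∣_) (*-comm k b) a∣m) =
  divides l (trans (cong (_* b) k≡la) (*-assoc l a b))

*-cancelˡ-∣⇔ : ∀ o {m n} .{{_ : NonZero o}} → o * m ∣ o * n ⇔ m ∣ n
*-cancelˡ-∣⇔ o = mk⇔ (*-cancelˡ-∣ o) (*-monoʳ-∣ o)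

coprime⇒∣*⇔∣ : ∀ {w m n} → Coprime w m → m ∣ w * n ⇔ m ∣ n
coprime⇒∣*⇔∣ {w} w⊥m = mk⇔ (coprime-divisor (Coprime.sym w⊥m)) (∣n⇒∣m*n w)

even⊎odd : ∀ n → (∃ λ h → n ≡ 2 * h) ⊎ (∃ λ h → n ≡ 1 + 2 * h)
even⊎odd zero = inj₁ (0 , refl)
even⊎odd (suc n) with even⊎odd n
... | inj₁ (h , refl) = inj₂ (h , refl)
... | inj₂ (h , refl) = inj₁ (suc h , cong suc (sym (+-suc h (h + 0))))

4⊥odd : ∀ h → Coprime 4 (1 + 2 * h)
4⊥odd h = noCommonPrime⇒coprime λ p-prime p∣4 p∣1+2h →
  prime∤1 prime[2] (∣m+n∣m⇒∣n (subst (2 ∣_) (+-comm 1 (2 * h)) (subst (_∣ 1 + 2 * h) (p≡2 p-prime p∣4) p∣1+2h))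
                               (divides h (*-comm 2 h)))
  where
  p≡2 : ∀ {p} → Prime p → p ∣ 4 → p ≡ 2
  p≡2 p-prime p∣4 = prime∣prime⇒≡ p-prime prime[2] ([ id , id ]′ (euclidsLemma 2 2 p-prime p∣4))

prime∣⇒1< : ∀ {p n} .{{_ : NonZero n}} → Prime p → p ∣ n → 1 < n
prime∣⇒1< {p} p-prime p∣n = <-≤-trans (nonTrivial⇒n>1 p {{prime⇒nonTrivial p-prime}}) (∣⇒≤ p∣n)

Πdistinct-primes∣ : ∀ {m ps} → Unique ps → All (λ p → Prime p × p ∣ m) ps → product ps ∣ m
Πdistinct-primes∣ [] [] = 1∣ _
Πdistinct-primes∣ {ps = p ∷ ps} (p∉ps ∷ unique) ((p-prime , p∣m) ∷ rest) =
  coprime⇒*-∣ (noCommonPrime⇒coprime p⊥Πps) p∣m (Πdistinct-primes∣ unique rest)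
  where
  p⊥Πps : ∀ {l} → Prime l → l ∣ p → l ∣ product ps → ⊥
  p⊥Πps l-prime l∣p l∣Πps with refl ← prime∣prime⇒≡ l-prime p-prime l∣p =
    All.lookup p∉ps (factorisationHasAllPrimeFactors l-prime l∣Πps (All.map proj₁ rest)) refl

rad∣⇔primes∣ : ∀ n .{{_ : NonZero n}} m → rad n ∣ m ⇔ (∀ {p} → Prime p → p ∣ n → p ∣ m)
rad∣⇔primes∣ n m = mk⇔ to from
  where
  P? = λ p → prime? p ×-dec (p ∣? n)
  to : rad n ∣ m → ∀ {p} → Prime p → p ∣ n → p ∣ m
  to rad∣m p-prime p∣n = ∣-trans (∈⇒∣product (∈-filter⁺ P? (∈-upTo⁺ (s≤s (∣⇒≤ p∣n))) (p-prime , p∣n))) rad∣m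
  from : (∀ {p} → Prime p → p ∣ n → p ∣ m) → rad n ∣ m
  from primes∣m = Πdistinct-primes∣ (filter⁺ P? (upTo⁺ (suc n))) (All.map divides-m (all-filter P? (upTo (suc n))))
    where
    divides-m : ∀ {p} → Prime p × p ∣ n → Prime p × p ∣ m
    divides-m (p-prime , p∣n) = p-prime , primes∣m p-prime p∣n

injective⇒surjective-Fin : ∀ {m} (f : Fin m → Fin m) → (∀ {i j} → i Fin.< j → f i ≢ f j) → ∀ y → ∃ λ i → f i ≡ y
injective⇒surjective-Fin {suc m} f injective y with any? (λ i → f i Fin.≟ y)
... | yes hit = hit
... | no miss with i , j , i<j , eq ← pigeonhole (n<1+n m) (λ k → punchOut (miss ∘ (k ,_) ∘ sym)) =
  ⊥-elim (injective i<j (punchOut-injective {i = y} _ _ eq))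

mod≡⇒%≡ : ∀ {a b n} .{{_ : NonZero n}} → a mod n ≡ b mod n → a % n ≡ b % n
mod≡⇒%≡ {a} {b} {n} eq = trans (sym (toℕ-fromℕ< (m%n<n a n))) (trans (cong toℕ eq) (toℕ-fromℕ< (m%n<n b n)))

injective⇒surjective-% : ∀ m .{{_ : NonZero m}} (g : ℕ → ℕ) → (∀ {i j} → i < j → j < m → g i % m ≢ g j % m) →
                         ∀ {y} → y < m → ∃ λ i → i < m × g i % m ≡ y
injective⇒surjective-% m g injective {y} y<m = preimage (injective⇒surjective-Fin f f-injective (y mod m))
  where
  f : Fin m → Fin m
  f k = g (toℕ k) mod m
  f-injective : ∀ {i j} → i Fin.< j → f i ≢ f j
  f-injective {j = j} i<j = injective i<j (toℕ<n j) ∘ mod≡⇒%≡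
  preimage : (∃ λ i → f i ≡ y mod m) → ∃ λ i → i < m × g i % m ≡ y
  preimage (i , fi≡y) = toℕ i , toℕ<n i , trans (mod≡⇒%≡ fi≡y) (m<n⇒m%n≡m y<m)

+-*-injective-% : ∀ {p d} c .{{_ : NonZero p}} → Prime p → ¬ p ∣ d → ∀ {i j} → i < j → j < p → (c + i * d) % p ≢ (c + j * d) % p
+-*-injective-% {p} {d} c p-prime p∤d {i} {j} i<j j<p eq =
  [ p∤j∸i , p∤d ]′ (euclidsLemma (j ∸ i) d p-prime ([m+n]%o≡m%o⇒o∣n (c + i * d) _ p (trans (cong (_% p) shift) (sym eq))))
  where
  open ≡-Reasoning
  shift : c + i * d + (j ∸ i) * d ≡ c + j * d
  shift = begin
    c + i * d + (j ∸ i) * d    ≡⟨ +-assoc c (i * d) _ ⟩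
    c + (i * d + (j ∸ i) * d)  ≡⟨ cong (c +_) (*-distribʳ-+ d i (j ∸ i)) ⟨
    c + (i + (j ∸ i)) * d      ≡⟨ cong (λ k → c + k * d) (m+[n∸m]≡n (<⇒≤ i<j)) ⟩
    c + j * d                  ∎
  p∤j∸i : ¬ p ∣ j ∸ i
  p∤j∸i = >⇒∤ {{>-nonZero (m<n⇒0<n∸m i<j)}} (≤-<-trans (m∸n≤m j i) j<p)

∃[j]p∣1+j*d : ∀ {p d} → Prime p → ¬ p ∣ d → ∃ λ j → j < p × p ∣ 1 + j * d
∃[j]p∣1+j*d {p} {d} p-prime p∤d =
  map₂ (map₂ (m%n≡0⇒n∣m _ p)) (injective⇒surjective-% p (λ j → 1 + j * d) (+-*-injective-% 1 p-prime p∤d) (>-nonZero⁻¹ p))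
  where instance _ = prime⇒nonZero p-prime

module _ {P : ℕ → Set} (P? : Decidable P) where

  minimal : ∀ t → P t → ∃ λ τ → P τ × (∀ {u} → u < τ → ¬ P u)
  minimal = <-rec _ descend
    where
    descend : ∀ t → (∀ {u} → u < t → P u → ∃ λ τ → P τ × (∀ {u} → u < τ → ¬ P u)) →
              P t → ∃ λ τ → P τ × (∀ {u} → u < τ → ¬ P u)
    descend t smaller Pt with anyUpTo? P? t
    ... | yes (u , u<t , Pu) = smaller u<t Pu
    ... | no none = t , Pt , λ u<t Pu → none (_ , u<t , Pu)

periodic : ∀ {q n} .{{_ : NonZero q}} .{{_ : NonZero n}} → Coprime q n → ∃ λ k → 0 < k × q ^ k % n ≡ 1 % n
periodic {q} {n} cop = repeat (pigeonhole (n<1+n n) (λ i → q ^ toℕ i mod n))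
  where
  repeat : (∃₂ λ i j → i Fin.< j × q ^ toℕ i mod n ≡ q ^ toℕ j mod n) → ∃ λ k → 0 < k × q ^ k % n ≡ 1 % n
  repeat (i , j , i<j , eq) = k , m<n⇒0<n∸m i<j ,
    sym (*-cancelˡ-% (Coprime.sym (coprime-^ a cop)) (m^n>0 q k) (begin
      (q ^ a * 1) % n      ≡⟨ cong (_% n) (*-identityʳ (q ^ a)) ⟩
      q ^ a % n            ≡⟨ mod≡⇒%≡ eq ⟩
      q ^ toℕ j % n        ≡⟨ cong (λ e → q ^ e % n) (m+[n∸m]≡n (<⇒≤ i<j)) ⟨
      q ^ (a + k) % n      ≡⟨ cong (_% n) (^-distribˡ-+-* q a k) ⟩
      (q ^ a * q ^ k) % n  ∎))
    where
    open ≡-Reasoning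
    a = toℕ i
    k = toℕ j ∸ a

∃order : ∀ {q n} .{{_ : NonZero q}} .{{_ : NonZero n}} → Coprime q n → ∃ λ τ → IsCosetSize n q 1 τ
∃order {q} {n} cop = least (periodic cop)
  where
  P? : Decidable (λ u → 0 < u × (1 * q ^ u) % n ≡ 1 % n)
  P? u = (0 <? u) ×-dec ((1 * q ^ u) % n ≟ 1 % n)
  least : (∃ λ k → 0 < k × q ^ k % n ≡ 1 % n) → ∃ λ τ → IsCosetSize n q 1 τ
  least (k , 0<k , q^k≡1)
    with τ , (0<τ , q^τ≡1) , below ← minimal P? k (0<k , subst (λ x → x % n ≡ 1 % n) (sym (*-identityˡ (q ^ k))) q^k≡1) =
    τ , 0<τ , q^τ≡1 , λ t 0<t t<τ → below t<τ ∘ (0<t ,_)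

square≡1⇒powers : ∀ {n} c .{{_ : NonZero n}} → (c * c) % n ≡ 1 % n → ∀ i → c ^ i % n ≡ 1 % n ⊎ c ^ i % n ≡ c % n
square≡1⇒powers c c²≡1 zero = inj₁ refl
square≡1⇒powers c c²≡1 (suc i) with square≡1⇒powers c c²≡1 i
... | inj₁ c^i≡1 = inj₂ (trans (*-congˡ-% c c^i≡1) (cong (_% _) (*-identityʳ c)))
... | inj₂ c^i≡c = inj₁ (trans (*-congˡ-% c c^i≡c) c²≡1)

[3+4u]^i%8≢5 : ∀ u i → (3 + u * 4) ^ i % 8 ≢ 5
[3+4u]^i%8≢5 u i q^i≡5 = [ (λ q^i≡1 → contradiction (trans (sym q^i≡5) q^i≡1) λ ())
                         , (λ q^i≡q → contradiction (trans (cong (_% 4) (trans (sym q^i≡5) q^i≡q)) q%8%4≡3) λ ())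
                         ]′ (square≡1⇒powers q q²≡1 i)
  where
  q = 3 + u * 4
  square : ∀ u → (3 + u * 4) * (3 + u * 4) ≡ 1 + (1 + 3 * u + 2 * u * u) * 8
  square = solve-∀
  q²≡1 : (q * q) % 8 ≡ 1
  q²≡1 = trans (cong (_% 8) (square u)) ([m+kn]%n≡m%n 1 (1 + 3 * u + 2 * u * u) 8)
  q%8%4≡3 : q % 8 % 4 ≡ 3
  q%8%4≡3 = trans (m∣n⇒o%n%m≡o%m 4 8 q (divides 2 refl)) ([m+kn]%n≡m%n 3 u 4)

odd-power≡5[mod8]⇒4∣r : ∀ {r} i → 2 ∣ r → suc r ^ i % 8 ≡ 5 → 4 ∣ r
odd-power≡5[mod8]⇒4∣r i (divides s refl) q^i≡5 with even⊎odd s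
... | inj₁ (u , refl) = divides u (four u)
  where
  four : ∀ u → 2 * u * 2 ≡ u * 4
  four = solve-∀
... | inj₂ (u , refl) = contradiction (subst (λ q → q ^ i % 8 ≡ 5) (three u) q^i≡5) ([3+4u]^i%8≢5 u i)
  where
  three : ∀ u → suc ((1 + 2 * u) * 2) ≡ 3 + u * 4
  three = solve-∀

-- Geometric sums and lifting the exponent

geom : ℕ → ℕ → ℕ
geom q zero    = 0
geom q (suc t) = 1 + q * geom q t

^≡1+r*geom : ∀ r t → suc r ^ t ≡ 1 + r * geom (suc r) t
^≡1+r*geom r zero    = cong suc (sym (*-zeroʳ r))
^≡1+r*geom r (suc t) = begin
  suc r * suc r ^ t                    ≡⟨ cong (suc r *_) (^≡1+r*geom r t) ⟩
  suc r * (1 + r * geom (suc r) t)     ≡⟨ expand r (geom (suc r) t) ⟩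
  1 + r * (1 + suc r * geom (suc r) t) ∎
  where
  open ≡-Reasoning
  expand : ∀ r g → suc r * (1 + r * g) ≡ 1 + r * (1 + suc r * g)
  expand = solve-∀

geom-+ : ∀ q a b → geom q (a + b) ≡ geom q a + q ^ a * geom q b
geom-+ q zero    b = sym (+-identityʳ (geom q b))
geom-+ q (suc a) b = begin
  1 + q * geom q (a + b)                  ≡⟨ cong (λ g → 1 + q * g) (geom-+ q a b) ⟩
  1 + q * (geom q a + q ^ a * geom q b)   ≡⟨ distribute q (geom q a) (q ^ a) (geom q b) ⟩
  1 + q * geom q a + q * q ^ a * geom q b ∎
  where
  open ≡-Reasoning
  distribute : ∀ q x y z → 1 + q * (x + y * z) ≡ 1 + q * x + q * y * z
  distribute = solve-∀

geom-* : ∀ q s k → geom q (k * s) ≡ geom q s * geom (q ^ s) k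
geom-* q s zero    = sym (*-zeroʳ (geom q s))
geom-* q s (suc k) = begin
  geom q (s + k * s)                              ≡⟨ geom-+ q s (k * s) ⟩
  geom q s + q ^ s * geom q (k * s)               ≡⟨ cong (λ g → geom q s + q ^ s * g) (geom-* q s k) ⟩
  geom q s + q ^ s * (geom q s * geom (q ^ s) k)  ≡⟨ factor (geom q s) (q ^ s) (geom (q ^ s) k) ⟩
  geom q s * (1 + q ^ s * geom (q ^ s) k)         ∎
  where
  open ≡-Reasoning
  factor : ∀ x y z → x + y * (x * z) ≡ x * (1 + y * z)
  factor = solve-∀

∃[v]geom≡t+r*v : ∀ r t → ∃ λ v → geom (suc r) t ≡ t + r * v
∃[v]geom≡t+r*v r zero    = 0 , sym (*-zeroʳ r)
∃[v]geom≡t+r*v r (suc t) with v , eq ← ∃[v]geom≡t+r*v r t = v + geom (suc r) t , (begin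
  1 + suc r * geom (suc r) t            ≡⟨ expand r (geom (suc r) t) ⟩
  1 + geom (suc r) t + r * geom (suc r) t ≡⟨ cong (λ g → 1 + g + r * geom (suc r) t) eq ⟩
  1 + (t + r * v) + r * geom (suc r) t  ≡⟨ collect r t v (geom (suc r) t) ⟩
  suc t + r * (v + geom (suc r) t)      ∎)
  where
  open ≡-Reasoning
  expand : ∀ r g → 1 + suc r * g ≡ 1 + g + r * g
  expand = solve-∀
  collect : ∀ r t v g → 1 + (t + r * v) + r * g ≡ suc t + r * (v + g)
  collect = solve-∀

∣geom⇒∣ : ∀ {d r} t → d ∣ r → d ∣ geom (suc r) t → d ∣ t
∣geom⇒∣ {d} {r} t d∣r d∣geom with v , eq ← ∃[v]geom≡t+r*v r t =
  ∣m+n∣m⇒∣n (subst (d ∣_) (trans eq (+-comm t (r * v))) d∣geom) (∣m⇒∣m*n v d∣r)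

geom-odd : ∀ z h → ∃ λ e → geom (suc z) (1 + 2 * h) ≡ (1 + 2 * h) * (1 + z * h) + z * z * e
geom-odd z zero    = 0 , base z
  where
  base : ∀ z → 1 + suc z * 0 ≡ 1 * (1 + z * 0) + z * z * 0
  base = solve-∀
geom-odd z (suc h) with e , eq ← geom-odd z h =
  e + (1 + 2 * h) * (2 * h + 1 + z * h) + z * e * (2 + z) , (begin
    geom (suc z) (1 + 2 * suc h)                 ≡⟨ cong (λ t → geom (suc z) (suc t)) (*-suc 2 h) ⟩
    1 + suc z * (1 + suc z * geom (suc z) (1 + 2 * h)) ≡⟨ cong (λ g → 1 + suc z * (1 + suc z * g)) eq ⟩
    1 + suc z * (1 + suc z * ((1 + 2 * h) * (1 + z * h) + z * z * e)) ≡⟨ step z h e ⟩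
    (1 + 2 * suc h) * (1 + z * suc h) + z * z * (e + (1 + 2 * h) * (2 * h + 1 + z * h) + z * e * (2 + z)) ∎)
  where
  open ≡-Reasoning
  step : ∀ z h e → 1 + suc z * (1 + suc z * ((1 + 2 * h) * (1 + z * h) + z * z * e)) ≡
                   (1 + 2 * suc h) * (1 + z * suc h) + z * z * (e + (1 + 2 * h) * (2 * h + 1 + z * h) + z * e * (2 + z))
  step = solve-∀

geom-prime : ∀ {p z} → Prime p → p ∣ z → ∃ λ w → geom (suc z) p ≡ p * w × ((p ≡ 2 → 4 ∣ z) → ¬ p ∣ w)
geom-prime {p} {z} p-prime p∣z with even⊎odd p
... | inj₁ (h , p≡2h) with refl ← prime∣prime⇒≡ prime[2] p-prime (divides h (trans p≡2h (*-comm 2 h)))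
                      with divides y refl ← p∣z = 1 + y , at-2 y , 2∤1+y
  where
  at-2 : ∀ y → geom (suc (y * 2)) 2 ≡ 2 * (1 + y)
  at-2 y = unfolded y
    where
    unfolded : ∀ y → 1 + suc (y * 2) * (1 + suc (y * 2) * 0) ≡ 2 * (1 + y)
    unfolded = solve-∀
  2∤1+y : (2 ≡ 2 → 4 ∣ y * 2) → ¬ 2 ∣ 1 + y
  2∤1+y 4∣z 2∣1+y = prime∤1 prime[2] (∣m+n∣m⇒∣n (subst (2 ∣_) (+-comm 1 y) 2∣1+y) (*-cancelʳ-∣ 2 (4∣z refl)))
... | inj₂ (h , refl) with divides c refl ← p∣z with e , eq ← geom-odd (c * p) h =
  1 + p * (c * h + c * c * e) , trans eq (factor p c h e) , λ _ p∣w →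
    prime∤1 p-prime (∣m+n∣m⇒∣n (subst (p ∣_) (+-comm 1 _) p∣w) (m∣m*n (c * h + c * c * e)))
  where
  factor : ∀ p c h e → p * (1 + c * p * h) + c * p * (c * p) * e ≡ p * (1 + p * (c * h + c * c * e))
  factor = solve-∀

record LiftingHypothesis (r m : ℕ) : Set where
  field
    prime∣r : ∀ {p} → Prime p → p ∣ m → p ∣ r
    4∣r     : 4 ∣ m → 4 ∣ r

open LiftingHypothesis

LiftingHypothesis-∣ : ∀ {r m k} → m ∣ k → LiftingHypothesis r k → LiftingHypothesis r m
LiftingHypothesis-∣ m∣k hyp = record
  { prime∣r = λ p-prime p∣m → prime∣r hyp p-prime (∣-trans p∣m m∣k)
  ; 4∣r     = λ 4∣m → 4∣r hyp (∣-trans 4∣m m∣k)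
  }

geom-*-prime : ∀ {r p m} → Prime p → LiftingHypothesis r (p * m) → ∀ s →
               ∃ λ w → geom (suc r) (p * s) ≡ p * (w * geom (suc r) s) × Coprime w m
geom-*-prime {r} {p} {m} p-prime hyp s
  with w , eq , p∤w ← geom-prime {z = r * geom (suc r) s} p-prime (∣m⇒∣m*n _ (prime∣r hyp p-prime (m∣m*n m))) =
  w , geom[ps]≡ , noCommonPrime⇒coprime w⊥m
  where
  open ≡-Reasoning
  S = geom (suc r) s
  geom[ps]≡ : geom (suc r) (p * s) ≡ p * (w * S)
  geom[ps]≡ = begin
    geom (suc r) (p * s)          ≡⟨ geom-* (suc r) s p ⟩
    S * geom (suc r ^ s) p        ≡⟨ cong (λ x → S * geom x p) (^≡1+r*geom r s) ⟩
    S * geom (suc (r * S)) p      ≡⟨ cong (S *_) eq ⟩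
    S * (p * w)                   ≡⟨ rearrange S p w ⟩
    p * (w * S)                   ∎
    where
    rearrange : ∀ x y z → x * (y * z) ≡ y * (z * x)
    rearrange = solve-∀
  w⊥m : ∀ {l} → Prime l → l ∣ w → l ∣ m → ⊥
  w⊥m {l} l-prime l∣w l∣m = p∤w 4∣z (subst (_∣ w) l≡p l∣w)
    where
    l∣r = prime∣r hyp l-prime (∣n⇒∣m*n p l∣m)
    l≡p = prime∣prime⇒≡ l-prime p-prime (∣geom⇒∣ p (∣m⇒∣m*n S l∣r) (subst (l ∣_) (sym eq) (∣n⇒∣m*n p l∣w)))
    4∣z : p ≡ 2 → 4 ∣ r * S
    4∣z p≡2 = ∣m⇒∣m*n S (4∣r hyp (subst (λ x → x * x ∣ p * m) p≡2 (*-monoʳ-∣ p (subst (_∣ m) l≡p l∣m))))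

geom-∣⇔∣-peel : ∀ {r p m} → Prime p → LiftingHypothesis r (p * m) → (∀ s → m ∣ geom (suc r) s ⇔ m ∣ s) →
                ∀ t → p * m ∣ geom (suc r) t ⇔ p * m ∣ t
geom-∣⇔∣-peel {r} {p} {m} p-prime hyp m-lifts t = mk⇔
  (λ pm∣geom → Equivalence.to (at (∣geom⇒∣ t p∣r (∣-trans (m∣m*n m) pm∣geom))) pm∣geom)
  (λ pm∣t → Equivalence.from (at (∣-trans (m∣m*n m) pm∣t)) pm∣t)
  where
  instance _ = prime⇒nonZero p-prime
  p∣r = prime∣r hyp p-prime (m∣m*n m)
  at-multiple : ∀ s → p * m ∣ geom (suc r) (p * s) ⇔ p * m ∣ p * s
  at-multiple s with w , eq , w⊥m ← geom-*-prime p-prime hyp s = begin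
    p * m ∣ geom (suc r) (p * s)      ≡⟨ cong (p * m ∣_) eq ⟩
    p * m ∣ p * (w * geom (suc r) s)  ∼⟨ *-cancelˡ-∣⇔ p ⟩
    m ∣ w * geom (suc r) s            ∼⟨ coprime⇒∣*⇔∣ w⊥m ⟩
    m ∣ geom (suc r) s                ∼⟨ m-lifts s ⟩
    m ∣ s                             ∼⟨ ⇔.sym (*-cancelˡ-∣⇔ p) ⟩
    p * m ∣ p * s                     ∎
    where open Related.EquationalReasoning
  at : p ∣ t → p * m ∣ geom (suc r) t ⇔ p * m ∣ t
  at p∣t = subst (λ x → p * m ∣ geom (suc r) x ⇔ p * m ∣ x) (sym (m∣n⇒n≡m*quotient p∣t)) (at-multiple (quotient p∣t))

geom-∣⇔∣ : ∀ {r} m .{{_ : NonZero m}} → LiftingHypothesis r m → ∀ t → m ∣ geom (suc r) t ⇔ m ∣ t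
geom-∣⇔∣ {r} = <-rec Lifts lifts
  where
  Lifts : ℕ → Set
  Lifts m = .{{_ : NonZero m}} → LiftingHypothesis r m → ∀ t → m ∣ geom (suc r) t ⇔ m ∣ t
  lifts : ∀ m → (∀ {k} → k < m → Lifts k) → Lifts m
  lifts 1 _ _ t = mk⇔ (λ _ → 1∣ t) (λ _ → 1∣ geom (suc r) t)
  lifts m@(suc (suc _)) smaller hyp with p , p-prime , p∣m ← ∃prime∣ {m} (s≤s (s≤s z≤n)) =
    subst Lifts-at (sym m≡pk) (geom-∣⇔∣-peel p-prime (subst (LiftingHypothesis r) m≡pk hyp)
                                 (smaller (quotient-< p∣m) (LiftingHypothesis-∣ (quotient-∣ p∣m) hyp)))
    where
    instance
      _ = prime⇒nonTrivial p-prime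
      _ = quotient≢0 p∣m
    m≡pk = m∣n⇒n≡m*quotient p∣m
    Lifts-at : ℕ → Set
    Lifts-at k = ∀ t → k ∣ geom (suc r) t ⇔ k ∣ t

-- Sufficiency

module CosetStructure {r n} .{{_ : NonZero n}} (primes∣r : ∀ {p} → Prime p → p ∣ n → p ∣ r) (8∣n⇒4∣r : 8 ∣ n → 4 ∣ r)
                      (γ : ℕ) where

  q = suc r

  -- Opaque: unfolding gcd during unification is prohibitively expensive.
  opaque
    D : ℕ
    D = gcd (γ * r) n

    instance
      D≢0 : NonZero D
      D≢0 = ≢-nonZero (gcd[m,n]≢0 (γ * r) n (inj₂ (≢-nonZero⁻¹ n)))

      M≢0 : NonZero (n / D)
      M≢0 = ≢-nonZero (n/gcd[m,n]≢0 (γ * r) n)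

    D∣γ*r : D ∣ γ * r
    D∣γ*r = gcd[m,n]∣m (γ * r) n

    D∣n : D ∣ n
    D∣n = gcd[m,n]∣n (γ * r) n

    ∣γ*r⇒∣n⇒∣D : ∀ {c} → c ∣ γ * r → c ∣ n → c ∣ D
    ∣γ*r⇒∣n⇒∣D = gcd-greatest

    a⊥M : Coprime (γ * r / D) (n / D)
    a⊥M = coprime-/gcd (γ * r) n

  M = n / D
  a = γ * r / D

  D*M≡n : D * M ≡ n
  D*M≡n = m*[n/m]≡n D∣n

  M∣n : M ∣ n
  M∣n = divides D (sym D*M≡n)

  M-lifts : LiftingHypothesis r M
  M-lifts = record
    { prime∣r = λ p-prime p∣M → primes∣r p-prime (∣-trans p∣M M∣n)
    ; 4∣r     = λ 4∣M → 8∣n⇒4∣r (subst (8 ∣_) (trans (*-comm M D) D*M≡n) (*-pres-∣ 4∣M (2∣D 4∣M)))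
    }
    where
    2∣D : 4 ∣ M → 2 ∣ D
    2∣D 4∣M = ∣γ*r⇒∣n⇒∣D (∣n⇒∣m*n γ (primes∣r prime[2] 2∣n)) 2∣n
      where 2∣n = ∣-trans (divides 2 refl) (∣-trans 4∣M M∣n)

  γ*q^t≡ : ∀ t → γ * q ^ t ≡ γ + D * (a * geom q t)
  γ*q^t≡ t = begin
    γ * q ^ t                 ≡⟨ cong (γ *_) (^≡1+r*geom r t) ⟩
    γ * (1 + r * geom q t)    ≡⟨ distribute γ r (geom q t) ⟩
    γ + γ * r * geom q t      ≡⟨ cong (λ x → γ + x * geom q t) (m*[n/m]≡n D∣γ*r) ⟨
    γ + D * a * geom q t      ≡⟨ cong (γ +_) (*-assoc D a (geom q t)) ⟩
    γ + D * (a * geom q t)    ∎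
    where
    open ≡-Reasoning
    distribute : ∀ g r s → g * (1 + r * s) ≡ g + g * r * s
    distribute = solve-∀

  returns⇔M∣geom : ∀ t → (γ * q ^ t) % n ≡ γ % n ⇔ M ∣ geom q t
  returns⇔M∣geom t = begin
    (γ * q ^ t) % n ≡ γ % n                  ≡⟨ cong (λ x → x % n ≡ γ % n) (γ*q^t≡ t) ⟩
    (γ + D * (a * geom q t)) % n ≡ γ % n     ∼⟨ mk⇔ ([m+n]%o≡m%o⇒o∣n γ _ n) (%-remove-+ʳ γ) ⟩
    n ∣ D * (a * geom q t)                   ≡⟨ cong (_∣ D * (a * geom q t)) D*M≡n ⟨
    D * M ∣ D * (a * geom q t)               ∼⟨ *-cancelˡ-∣⇔ D ⟩
    M ∣ a * geom q t                         ∼⟨ coprime⇒∣*⇔∣ a⊥M ⟩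
    M ∣ geom q t                             ∎
    where open Related.EquationalReasoning

  size≡M : ∀ {τ} → IsCosetSize n q γ τ → τ ≡ M
  size≡M {τ} (0<τ , returns , earliest) = ≤-antisym τ≤M M≤τ
    where
    M∣geom⇔M∣ = geom-∣⇔∣ M M-lifts
    M≤τ : M ≤ τ
    M≤τ = ∣⇒≤ {{>-nonZero 0<τ}} (Equivalence.to (M∣geom⇔M∣ τ) (Equivalence.to (returns⇔M∣geom τ) returns))
    τ≤M : τ ≤ M
    τ≤M = ≮⇒≥ λ M<τ → earliest M (>-nonZero⁻¹ M) M<τ
                        (Equivalence.from (returns⇔M∣geom M) (Equivalence.from (M∣geom⇔M∣ M) ∣-refl))

  residue : ℕ → ℕ
  residue i = a * geom q i % M

  γ*q^i≡γ+residue*D : ∀ i → (γ * q ^ i) % n ≡ (γ + residue i * D) % n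
  γ*q^i≡γ+residue*D i = begin
    (γ * q ^ i) % n                      ≡⟨ cong (_% n) (γ*q^t≡ i) ⟩
    (γ + D * y) % n                      ≡⟨ cong (λ y → (γ + D * y) % n) (m≡m%n+[m/n]*n y M) ⟩
    (γ + D * (y % M + y / M * M)) % n    ≡⟨ cong (_% n) (split γ D (y % M) (y / M) M) ⟩
    (γ + y % M * D + y / M * (D * M)) % n ≡⟨ cong (λ m → (γ + y % M * D + y / M * m) % n) D*M≡n ⟩
    (γ + y % M * D + y / M * n) % n      ≡⟨ [m+kn]%n≡m%n (γ + y % M * D) (y / M) n ⟩
    (γ + residue i * D) % n              ∎
    where
    open ≡-Reasoning
    y = a * geom q i
    split : ∀ g d u v m → g + d * (u + v * m) ≡ g + u * d + v * (d * m)
    split = solve-∀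

  q^i⊥M : ∀ i → Coprime (q ^ i) M
  q^i⊥M i = coprime-^ i (noCommonPrime⇒coprime λ {p} p-prime p∣q p∣M →
    prime∤1 p-prime (∣m+n∣m⇒∣n (subst (p ∣_) (+-comm 1 r) p∣q) (prime∣r M-lifts p-prime p∣M)))

  residue-injective : ∀ {i j} → i < j → j < M → residue i ≢ residue j
  residue-injective {i} {j} i<j j<M residue≡ = >⇒∤ {{>-nonZero (m<n⇒0<n∸m i<j)}} (≤-<-trans (m∸n≤m j i) j<M) M∣k
    where
    open ≡-Reasoning
    k = j ∸ i
    a*geom[j]≡ : a * geom q j ≡ a * geom q i + a * (q ^ i * geom q k)
    a*geom[j]≡ = begin
      a * geom q j                          ≡⟨ cong (λ t → a * geom q t) (m+[n∸m]≡n (<⇒≤ i<j)) ⟨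
      a * geom q (i + k)                    ≡⟨ cong (a *_) (geom-+ q i k) ⟩
      a * (geom q i + q ^ i * geom q k)     ≡⟨ *-distribˡ-+ a (geom q i) _ ⟩
      a * geom q i + a * (q ^ i * geom q k) ∎
    M∣a*q^i*geom : M ∣ a * (q ^ i * geom q k)
    M∣a*q^i*geom = [m+n]%o≡m%o⇒o∣n (a * geom q i) _ M (trans (cong (_% M) (sym a*geom[j]≡)) (sym residue≡))
    M∣k : M ∣ k
    M∣k = Equivalence.to (geom-∣⇔∣ M M-lifts k)
            (Equivalence.to (coprime⇒∣*⇔∣ (q^i⊥M i)) (Equivalence.to (coprime⇒∣*⇔∣ a⊥M) M∣a*q^i*geom))

  equalDifference : EqualDifference n q γ
  equalDifference τ size with refl ← size≡M size = D , trans (*-comm M D) D*M≡n , λ x → mk⇔ (to x) (from x)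
    where
    to : ∀ x → InCoset n q γ x → ∃ λ j → j < M × x % n ≡ (γ + j * D) % n
    to x (i , x≡) = residue i , m%n<n _ M , trans x≡ (γ*q^i≡γ+residue*D i)
    from : ∀ x → (∃ λ j → j < M × x % n ≡ (γ + j * D) % n) → InCoset n q γ x
    from x (j , j<M , x≡) with i , _ , residue≡j ← injective⇒surjective-% M (λ i → a * geom q i) residue-injective j<M =
      i , trans x≡ (trans (cong (λ k → (γ + k * D) % n) (sym residue≡j)) (sym (γ*q^i≡γ+residue*D i)))

-- Necessity

module EqualDifferenceCosetOfOne {r n τ d} .{{_ : NonZero n}} (q⊥n : Coprime (suc r) n) (0<τ : 0 < τ) (τ*d≡n : τ * d ≡ n)
         (coset : ∀ x → InCoset n (suc r) 1 x ⇔ (∃ λ j → j < τ × x % n ≡ (1 + j * d) % n)) where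

  q = suc r

  instance
    τ≢0 : NonZero τ
    τ≢0 = >-nonZero 0<τ

  power : ∀ {j} → j < τ → ∃ λ i → (1 + j * d) % n ≡ (1 * q ^ i) % n
  power {j} j<τ = Equivalence.from (coset (1 + j * d)) (j , j<τ , refl)

  q≡1+j*d : ∃ λ j → q % n ≡ (1 + j * d) % n
  q≡1+j*d = map₂ proj₂ (Equivalence.to (coset q) (1 , cong (_% n) (sym (trans (*-identityˡ (q ^ 1)) (*-identityʳ q)))))

  ∣n∣d⇒∣r : ∀ {m} .{{_ : NonZero m}} → m ∣ n → m ∣ d → m ∣ r
  ∣n∣d⇒∣r {m} m∣n m∣d with j , q≡ ← q≡1+j*d = [m+n]%o≡m%o⇒o∣n 1 r m (begin
    q % m            ≡⟨ %-≡-divisor q (1 + j * d) m∣n q≡ ⟩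
    (1 + j * d) % m  ≡⟨ %-remove-+ʳ 1 (∣n⇒∣m*n j m∣d) ⟩
    1 % m            ∎)
    where open ≡-Reasoning

  prime∣n⇒prime∣d : ∀ {p} → Prime p → p ∣ n → p ∣ d
  prime∣n⇒prime∣d {p} p-prime p∣n with p ∣? d
  ... | yes p∣d = p∣d
  ... | no p∤d = ⊥-elim (power-hits (∃[j]p∣1+j*d p-prime p∤d))
    where
    instance _ = prime⇒nonZero p-prime
    p∣τ : p ∣ τ
    p∣τ = [ id , ⊥-elim ∘ p∤d ]′ (euclidsLemma τ d p-prime (subst (p ∣_) (sym τ*d≡n) p∣n))
    power-hits : (∃ λ j → j < p × p ∣ 1 + j * d) → ⊥
    power-hits (j , j<p , p∣1+j*d) with i , 1+j*d≡q^i ← power (<-≤-trans j<p (∣⇒≤ p∣τ)) =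
      coprime⇒¬commonPrime q⊥n p-prime (prime∣^⇒prime∣ q i p-prime p∣q^i) p∣n
      where
      p∣q^i = subst (p ∣_) (*-identityˡ (q ^ i)) (∣-resp-%≡ p∣n 1+j*d≡q^i p∣1+j*d)

  prime∣n⇒prime∣r : ∀ {p} → Prime p → p ∣ n → p ∣ r
  prime∣n⇒prime∣r p-prime p∣n = ∣n∣d⇒∣r {{prime⇒nonZero p-prime}} p∣n (prime∣n⇒prime∣d p-prime p∣n)

  8∣n⇒4∣τ : ∀ {h} → 8 ∣ n → d ≡ (1 + 2 * h) * 2 → 4 ∣ τ
  8∣n⇒4∣τ {h} 8∣n d≡ = coprime-divisor (4⊥odd h) (*-cancelʳ-∣ 2 (subst (8 ∣_) n≡ 8∣n))
    where
    rearrange : ∀ t o → t * (o * 2) ≡ o * t * 2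
    rearrange = solve-∀
    n≡ : n ≡ (1 + 2 * h) * τ * 2
    n≡ = trans (sym τ*d≡n) (trans (cong (τ *_) d≡) (rearrange τ (1 + 2 * h)))

  8∣n⇒4∣r : 8 ∣ n → 4 ∣ r
  8∣n⇒4∣r 8∣n with prime∣n⇒prime∣d prime[2] (∣-trans (divides 4 refl) 8∣n)
  ... | divides e d≡e*2 with even⊎odd e
  ... | inj₁ (h , refl) = ∣n∣d⇒∣r (∣-trans (divides 2 refl) 8∣n) (divides h (trans d≡e*2 (four h)))
    where
    four : ∀ h → 2 * h * 2 ≡ h * 4
    four = solve-∀
  ... | inj₂ (h , refl) with i , 1+2d≡q^i ← power (<-≤-trans (s≤s (s≤s (s≤s z≤n))) (∣⇒≤ (8∣n⇒4∣τ {h} 8∣n d≡e*2))) =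
    odd-power≡5[mod8]⇒4∣r i (∣n∣d⇒∣r (∣-trans (divides 4 refl) 8∣n) (divides (1 + 2 * h) d≡e*2)) (begin
      q ^ i % 8            ≡⟨ cong (_% 8) (*-identityˡ (q ^ i)) ⟨
      (1 * q ^ i) % 8      ≡⟨ %-≡-divisor _ _ 8∣n 1+2d≡q^i ⟨
      (1 + 2 * d) % 8      ≡⟨ cong (λ d → (1 + 2 * d) % 8) d≡e*2 ⟩
      (1 + 2 * ((1 + 2 * h) * 2)) % 8 ≡⟨ cong (_% 8) (five h) ⟩
      (5 + h * 8) % 8      ≡⟨ [m+kn]%n≡m%n 5 h 8 ⟩
      5                    ∎)
    where
    open ≡-Reasoning
    five : ∀ h → 1 + 2 * ((1 + 2 * h) * 2) ≡ 5 + h * 8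
    five = solve-∀

equalDifference[1]⇒conditions : ∀ {r n} .{{_ : NonZero n}} → Coprime (suc r) n → EqualDifference n (suc r) 1 →
                                (∀ {p} → Prime p → p ∣ n → p ∣ r) × (8 ∣ n → 4 ∣ r)
equalDifference[1]⇒conditions q⊥n equalDifference with τ , size ← ∃order q⊥n
  with d , τ*d≡n , coset ← equalDifference τ size = prime∣n⇒prime∣r , 8∣n⇒4∣r
  where open EqualDifferenceCosetOfOne q⊥n (proj₁ size) τ*d≡n coset

corollary3p1 : (q n : ℕ) → .{{_ : NonZero n}} → IsPrimePower q → Coprime q n →
    (∀ γ → γ < n → EqualDifference n q γ) ⇔
      ((rad n ∣ q ∸ 1) × (8 ∣ n → q % 4 ≡ 1))
corollary3p1 zero n (p , k , p-prime , _ , 0≡p^k) _ =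
  ⊥-elim (≢-nonZero⁻¹ p {{prime⇒nonZero p-prime}} (m^n≡0⇒m≡0 p k (sym 0≡p^k)))
corollary3p1 (suc r) n _ q⊥n = mk⇔
  (λ allEqualDifference → necessary (λ 1<n → equalDifference[1]⇒conditions q⊥n (allEqualDifference 1 1<n)))
  (λ (rad∣r , 8∣n⇒q≡1) γ _ →
     CosetStructure.equalDifference (Equivalence.to (rad∣⇔primes∣ n r) rad∣r) (Equivalence.to q≡1⇔4∣r ∘ 8∣n⇒q≡1) γ)
  where
  q≡1⇔4∣r : suc r % 4 ≡ 1 ⇔ 4 ∣ r
  q≡1⇔4∣r = mk⇔ ([m+n]%o≡m%o⇒o∣n 1 r 4) (%-remove-+ʳ 1)
  necessary : (1 < n → (∀ {p} → Prime p → p ∣ n → p ∣ r) × (8 ∣ n → 4 ∣ r)) → (rad n ∣ r) × (8 ∣ n → suc r % 4 ≡ 1)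
  necessary conditions =
    Equivalence.from (rad∣⇔primes∣ n r) (λ p-prime p∣n → proj₁ (conditions (prime∣⇒1< p-prime p∣n)) p-prime p∣n) ,
    λ 8∣n → Equivalence.from q≡1⇔4∣r (proj₂ (conditions (prime∣⇒1< prime[2] (∣-trans (divides 4 refl) 8∣n))) 8∣n)
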